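{- Let $g\ge 1$ and $s\ge 4$ be integers such that every graph of Euler genus at most $g-1$ is identified by a sentence of $\mathsf{C}^{\mathrm{w}}_s$, and let $n\ge 1$. Let $h<g$. Then there is a sentence $\mathrm{genus}_h\in\mathsf{C}^{\mathrm{w}}_s$ such that for every graph $G$ of order $|G|\le n$ we have $G\models\mathrm{genus}_h$ if and only if $G$ has Euler genus at most $h$.
   Context: Graphs are finite, simple, undirected. The Euler genus of a graph is the least Euler genus of a surface it embeds in (orientable surface with $k$ handles: $2k$; non-orientable surface with $\ell$ crosscaps: $\ell$). $\mathsf{C}$ is first-order logic over graphs (edge relation $E$) with counting quantifiers $\exists^{\ge p}x$ ($p\ge 1$); a formula has width $k$ if each subformula has at most $k$ free variables; $\mathsf{C}^{\mathrm{w}}_k$ denotes the $\mathsf{C}$-formulae of width at most $k$. A sentence identifies $G$ if for all graphs $H$: $H\models\varphi$ iff $H\cong G$. -}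

module Defs where

open import Data.Nat using (ℕ; zero; suc; _+_; _*_; _≤_; _<_; _≡ᵇ_; _<ᵇ_)
open import Data.Nat.Properties using (_≟_)
open import Data.Bool using (Bool; true; false; _∧_; _∨_; not; if_then_else_; _xor_)
open import Data.Fin using (Fin; toℕ)
open import Data.List using (List; []; _∷_; length; deduplicate; upTo; allFin)
open import Data.Maybe using (Maybe; just; nothing)
open import Data.Product using (Σ; _×_; _,_; ∃)
open import Data.Empty using (⊥)
open import Relation.Binary.PropositionalEquality using (_≡_)
open import Function.Bundles using (Bijection; _⤖_)
open import Function.Definitions using (Injective)

record Graph : Set where
  field
    size    : ℕ
    adj     : Fin size → Fin size → Bool
    adj-sym : ∀ u v → adj u v ≡ adj v u
    adj-irr : ∀ u → adj u u ≡ false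
open Graph public

_≅_ : Graph → Graph → Set
G ≅ H = Σ (Fin (size G) ⤖ Fin (size H)) λ f →
          ∀ u v → adj H (Bijection.to f u) (Bijection.to f v) ≡ adj G u v

anyB : {A : Set} → (A → Bool) → List A → Bool
anyB p []       = false
anyB p (x ∷ xs) = p x ∨ anyB p xs

allB : {A : Set} → (A → Bool) → List A → Bool
allB p []       = true
allB p (x ∷ xs) = p x ∧ allB p xs

countB : {A : Set} → (A → Bool) → List A → ℕ
countB p []       = 0
countB p (x ∷ xs) = if p x then suc (countB p xs) else countB p xs

concatL : {A B : Set} → (A → List B) → List A → List B
concatL f []       = []
concatL f (x ∷ xs) = app (f x) (concatL f xs)
  where
  app : {B : Set} → List B → List B → List B
  app []       ys = ys
  app (z ∷ zs) ys = z ∷ app zs ys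

iter : {A : Set} → (A → A) → ℕ → A → A
iter f zero    x = x
iter f (suc k) x = f (iter f k x)

data Form : Set where
  rel  : ℕ → ℕ → Form
  eql  : ℕ → ℕ → Form
  neg  : Form → Form
  conj : Form → Form → Form
  disj : Form → Form → Form
  cnt  : ℕ → ℕ → Form → Form     -- cnt p i φ  =  ∃^{≥ p} x_i φ

removeVar : ℕ → List ℕ → List ℕ
removeVar i []       = []
removeVar i (j ∷ js) = if i ≡ᵇ j then removeVar i js else j ∷ removeVar i js

-- free variables (possibly with repetitions)
fv : Form → List ℕ
fv (rel i j)   = i ∷ j ∷ []
fv (eql i j)   = i ∷ j ∷ []
fv (neg φ)     = fv φ
fv (conj φ ψ)  = concatL (λ l → l) (fv φ ∷ fv ψ ∷ [])
fv (disj φ ψ)  = concatL (λ l → l) (fv φ ∷ fv ψ ∷ [])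
fv (cnt p i φ) = removeVar i (fv φ)

nfv : Form → ℕ
nfv φ = length (deduplicate _≟_ (fv φ))

InCw : ℕ → Form → Set
InCw k (rel i j)   = nfv (rel i j) ≤ k
InCw k (eql i j)   = nfv (eql i j) ≤ k
InCw k (neg φ)     = nfv (neg φ) ≤ k × InCw k φ
InCw k (conj φ ψ)  = nfv (conj φ ψ) ≤ k × InCw k φ × InCw k ψ
InCw k (disj φ ψ)  = nfv (disj φ ψ) ≤ k × InCw k φ × InCw k ψ
InCw k (cnt p i φ) = 1 ≤ p × nfv (cnt p i φ) ≤ k × InCw k φ

Sentence : Form → Set
Sentence φ = fv φ ≡ []

Assign : ℕ → Set
Assign n = ℕ → Maybe (Fin n)

_[_↦_] : {n : ℕ} → Assign n → ℕ → Fin n → Assign n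
(ρ [ i ↦ a ]) j = if i ≡ᵇ j then just a else ρ j

EdgeM : (G : Graph) → Maybe (Fin (size G)) → Maybe (Fin (size G)) → Set
EdgeM G (just u) (just v) = adj G u v ≡ true
EdgeM G _        _        = ⊥

EqM : {n : ℕ} → Maybe (Fin n) → Maybe (Fin n) → Set
EqM (just u) (just v) = u ≡ v
EqM _        _        = ⊥

Sat : (G : Graph) → Assign (size G) → Form → Set
Sat G ρ (rel i j)   = EdgeM G (ρ i) (ρ j)
Sat G ρ (eql i j)   = EqM (ρ i) (ρ j)
Sat G ρ (neg φ)     = Sat G ρ φ → ⊥
Sat G ρ (conj φ ψ)  = Sat G ρ φ × Sat G ρ ψ
Sat G ρ (disj φ ψ)  = Σ Bool λ b → if b then Sat G ρ φ else Sat G ρ ψ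
Sat G ρ (cnt p i φ) = Σ (Fin p → Fin (size G)) λ f →
                        Injective _≡_ _≡_ f × (∀ a → Sat G (ρ [ i ↦ f a ]) φ)

_⊨_ : Graph → Form → Set
G ⊨ φ = Sat G (λ _ → nothing) φ

Identifies : Form → Graph → Set
Identifies φ G = (H : Graph) → (H ⊨ φ → H ≅ G) × (H ≅ G → H ⊨ φ)

-- Euler genus, via combinatorial embedding schemes
-- (generalised rotation systems: rotation + edge signature),
-- cf. Mohar–Thomassen, Graphs on Surfaces, Sec. 3.3.

record Scheme (G : Graph) : Set where
  field
    succ pred : Fin (size G) → Fin (size G) → Fin (size G)
    succ-nbr  : ∀ v u → adj G v u ≡ true → adj G v (succ v u) ≡ true
    pred-nbr  : ∀ v u → adj G v u ≡ true → adj G v (pred v u) ≡ true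
    pred-succ : ∀ v u → adj G v u ≡ true → pred v (succ v u) ≡ u
    succ-pred : ∀ v u → adj G v u ≡ true → succ v (pred v u) ≡ u
    -- the local rotation at v is a single cyclic permutation of N(v)
    cyclic    : ∀ v u w → adj G v u ≡ true → adj G v w ≡ true →
                ∃ λ k → iter (succ v) k u ≡ w
    -- edge signature (true = twisted edge)
    sig       : Fin (size G) → Fin (size G) → Bool
    sig-sym   : ∀ u v → sig u v ≡ sig v u

-- flags (u, v, ε): dart u→v traversed in local state ε (true = +)
Flag : Graph → Set
Flag G = Fin (size G) × Fin (size G) × Bool

flags : (G : Graph) → List (Flag G)
flags G = concatL (λ u → concatL (λ v →
            if adj G u v then (u , v , true) ∷ (u , v , false) ∷ [] else [])
            (allFin (size G))) (allFin (size G))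

flagEq : {G : Graph} → Flag G → Flag G → Bool
flagEq (u , v , e) (u' , v' , e') =
  (toℕ u ≡ᵇ toℕ u') ∧ (toℕ v ≡ᵇ toℕ v') ∧ (if e then e' else not e')

step : {G : Graph} → Scheme G → Flag G → Flag G
step S (u , v , e) =
  let e' = e xor Scheme.sig S u v in
  (v , (if e' then Scheme.succ S v u else Scheme.pred S v u) , e')

inOrbit : {G : Graph} → Scheme G → ℕ → Flag G → Flag G → Bool
inOrbit {G} S N x y = anyB (λ k → flagEq {G} (iter (step S) k x) y) (upTo N)

countOrbits : {G : Graph} → Scheme G → ℕ → List (Flag G) → List (Flag G) → ℕ
countOrbits S N []       seen = 0
countOrbits S N (x ∷ xs) seen =
  if anyB (λ y → inOrbit S N y x) seen
  then countOrbits S N xs seen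
  else suc (countOrbits S N xs (x ∷ seen))

-- number of orbits of the face-tracing permutation on flags
-- (each face of the embedding corresponds to exactly two such orbits)
orbits : {G : Graph} → Scheme G → ℕ
orbits {G} S = countOrbits S (length (flags G)) (flags G) []

conn : (G : Graph) → ℕ → Fin (size G) → Fin (size G) → Bool
conn G zero    u v = toℕ u ≡ᵇ toℕ v
conn G (suc k) u v = conn G k u v ∨ anyB (λ w → conn G k u w ∧ adj G w v) (allFin (size G))

numComponents : Graph → ℕ
numComponents G = countB (λ x → allB (λ y → not ((toℕ y <ᵇ toℕ x) ∧ conn G (size G) y x))
                                     (allFin (size G))) (allFin (size G))

numIsolated : Graph → ℕ
numIsolated G = countB (λ v → not (anyB (adj G v) (allFin (size G)))) (allFin (size G))

-- number of darts = 2 |E(G)|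
numDarts : Graph → ℕ
numDarts G = length (concatL (λ u → concatL (λ v → if adj G u v then u ∷ [] else [])
               (allFin (size G))) (allFin (size G)))

-- G has Euler genus at most h: some embedding scheme S has
--   Σ_{components} (2 - V_i + E_i - F_i) ≤ h,
-- with F = orbits/2 + #isolated vertices, i.e. (multiplying by 2)
--   4c + 2|E| ≤ 2h + 2|V| + orbits(S) + 2·#isolated.
EulerGenus≤ : ℕ → Graph → Set
EulerGenus≤ h G = Σ (Scheme G) λ S →
  4 * numComponents G + numDarts G ≤ 2 * h + 2 * size G + orbits S + 2 * numIsolated G

-- The sentence is the disjunction, over all graphs G′ of order at most n and Euler genus at most h,
-- of sentences identifying G′; they exist by hypothesis because h ≤ g − 1. A graph of order at most n
-- satisfies the disjunction iff it is isomorphic to one of these G′, i.e. iff its Euler genus is at most h.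
-- Constructively this needs two facts about the combinatorial definition of Euler genus. It is decidable:
-- once the cyclicity witness is bounded by the order, there are finitely many embedding schemes. It is
-- invariant under isomorphism: transporting a scheme preserves the numbers of darts, isolated vertices,
-- components and face-tracing orbits. The last two are greedy counts of the classes of an equivalence
-- (being connected, lying on a common orbit), and such counts do not change when the counted list is
-- permuted or renamed.

module Submission where

open import Defs
open import Algebra.Bundles using (CommutativeMonoid)
open import Data.Bool using (Bool; true; false; _∧_; _∨_; not; if_then_else_; _xor_; T)
open import Data.Bool.Properties
  using (⇔→≡; ∨-assoc; ∨-comm; ∨-idem; ∨-commutativeMonoid; not-¬) renaming (_≟_ to _≟ᵇ_)
open import Algebra.Properties.CommutativeSemigroup (CommutativeMonoid.commutativeSemigroup ∨-commutativeMonoid)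
  using () renaming (x∙yz≈y∙xz to ∨-swap)
open import Data.Fin as Fin using (Fin; toℕ; fromℕ<)
open import Data.Fin.Properties
  using (toℕ-injective; toℕ<n; toℕ-fromℕ<; injective⇒≤; pigeonhole; all?; any?) renaming (_≟_ to _≟ᶠ_)
open import Data.List
  using (List; []; _∷_; _++_; length; lookup; map; concat; concatMap; allFin; upTo; cartesianProduct)
open import Data.List.Properties using (concatMap-cong; concatMap-map; map-concatMap; length-map; length-tabulate)
open import Data.List.Membership.Propositional using (_∈_; lose)
open import Data.List.Membership.Propositional.Properties
  using (∈-allFin; ∈-map⁺; ∈-upTo⁺; ∈-concatMap⁺; ∈-concatMap⁻; ∈-cartesianProduct⁺)
open import Data.List.Membership.Propositional.Properties.WithK using (unique∧set⇒bag)
open import Data.List.Relation.Binary.BagAndSetEquality using (∼bag⇒↭)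
open import Data.List.Relation.Binary.Permutation.Propositional as ↭
  using (_↭_; ↭-refl; ↭-reflexive; ↭-sym; ↭-trans; module PermutationReasoning)
open import Data.List.Relation.Binary.Permutation.Propositional.Properties
  using (++⁺; ++⁺ˡ; shifts; map⁺; ∈-resp-↭; All-resp-↭; ↭-length)
open import Data.List.Relation.Unary.All as All using (All; []; _∷_)
open import Data.List.Relation.Unary.All.Properties using () renaming (map⁺ to All-map⁺)
open import Data.List.Relation.Unary.AllPairs using (AllPairs; []; _∷_)
open import Data.List.Relation.Unary.AllPairs.Properties using (tabulate⁺-<)
open import Data.List.Relation.Unary.Any as Any using (Any; here; there; index)
open import Data.List.Relation.Unary.Any.Properties
  using (lookup-index) renaming (map⁺ to Any-map⁺; map⁻ to Any-map⁻)
open import Data.List.Relation.Unary.Unique.Propositional.Properties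
  using (allFin⁺) renaming (map⁺ to Unique-map⁺)
open import Data.Nat
  using (ℕ; zero; suc; _+_; _*_; _∸_; _≤_; _<_; _≤′_; ≤′-refl; ≤′-step; _≡ᵇ_; _<ᵇ_; _≤?_; _<?_
        ; z≤n; s≤s)
open import Data.Nat.Induction using (<-wellFounded)
open import Data.Nat.Properties
  using ( <⇒≤; ≤⇒≤′; ≤-pred; <-cmp; ≡ᵇ⇒≡; ≤∧≢⇒<; n<1+n; ≤-trans; ≤-reflexive; ≤-antisym; m<m+n
        ; +-suc; +-comm; *-suc; ≮⇒≥; m≤n⇒∃[o]m+o≡n; m∸n+n≡m; +-monoʳ-<; +-monoˡ-≤; *-monoʳ-≤
        ; <-≤-trans; suc[m]≤n⇒m≤pred[n])
  renaming (_≟_ to _≟ℕ_)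
open import Data.Product using (Σ; ∃; ∃₂; _×_; _,_; proj₁; proj₂)
open import Data.Sum using (_⊎_; inj₁; inj₂)
open import Data.Unit using (⊤)
open import Data.Vec.Functional using (Vector) renaming (_∷_ to _◂_)
open import Function using (id; _∘_; _∘′_; mk⇔)
open import Function.Bundles using (Bijection; Inverse)
open import Function.Construct.Identity using (⤖-id)
open import Function.Construct.Symmetry using (⤖-sym)
open import Function.Properties.Bijection using (⤖⇒↔)
open import Induction.WellFounded using (Acc; acc)
open import Relation.Binary.Definitions using (tri<; tri≈; tri>)
open import Relation.Binary.PropositionalEquality as ≡ using (_≡_; refl; cong; cong₂; sym; subst; subst₂)
open import Relation.Nullary using (Dec; yes; no; ¬_; contradiction)
open import Relation.Nullary.Decidable using (⌊_⌋; _×-dec_; _→-dec_; map′)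

-- `concatL` appends with a private copy of `_++_`, so it agrees with `concatMap` only propositionally.
concatL-id-∷ : {A : Set} (xs : List A) (xss : List (List A)) →
               concatL id (xs ∷ xss) ≡ xs ++ concatL id xss
concatL-id-∷ []       xss = refl
concatL-id-∷ (x ∷ xs) xss = cong (x ∷_) (concatL-id-∷ xs xss)

concatL-id : {A : Set} (xss : List (List A)) → concatL id xss ≡ concat xss
concatL-id []         = refl
concatL-id (xs ∷ xss) = ≡.trans (concatL-id-∷ xs xss) (cong (xs ++_) (concatL-id xss))

concatL-map : {A B : Set} (f : A → List B) (xs : List A) → concatL f xs ≡ concatL id (map f xs)
concatL-map f []       = refl
concatL-map f (x ∷ xs) rewrite concatL-map f xs = refl

concatL≡concatMap : {A B : Set} (f : A → List B) (xs : List A) → concatL f xs ≡ concatMap f xs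
concatL≡concatMap f xs = ≡.trans (concatL-map f xs) (concatL-id (map f xs))

concat⁺ : {A : Set} {xss yss : List (List A)} → xss ↭ yss → concat xss ↭ concat yss
concat⁺ ↭.refl           = ↭-refl
concat⁺ (↭.prep xs p)    = ++⁺ˡ xs (concat⁺ p)
concat⁺ (↭.swap xs ys p) = ↭-trans (shifts xs ys) (++⁺ˡ ys (++⁺ˡ xs (concat⁺ p)))
concat⁺ (↭.trans p q)    = ↭-trans (concat⁺ p) (concat⁺ q)

concatMap⁺ : {A B : Set} (f : A → List B) {xs ys : List A} → xs ↭ ys → concatMap f xs ↭ concatMap f ys
concatMap⁺ f p = concat⁺ (map⁺ f p)

concatMap-↭-pointwise : {A B : Set} {f g : A → List B} (xs : List A) → (∀ x → f x ↭ g x) →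
                        concatMap f xs ↭ concatMap g xs
concatMap-↭-pointwise []       f↭g = ↭-refl
concatMap-↭-pointwise (x ∷ xs) f↭g = ++⁺ (f↭g x) (concatMap-↭-pointwise xs f↭g)

anyB⁺ : {A : Set} (p : A → Bool) {x : A} {xs : List A} → x ∈ xs → p x ≡ true → anyB p xs ≡ true
anyB⁺ p {xs = y ∷ xs} (here refl) px = cong (_∨ anyB p xs) px
anyB⁺ p {xs = y ∷ xs} (there x∈xs) px with p y
... | true  = refl
... | false = anyB⁺ p x∈xs px

anyB⁻ : {A : Set} (p : A → Bool) (xs : List A) → anyB p xs ≡ true → ∃ λ x → x ∈ xs × p x ≡ true
anyB⁻ p (x ∷ xs) any≡true with p x in px
... | true  = x , here refl , px
... | false with anyB⁻ p xs any≡true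
...   | y , y∈xs , py = y , there y∈xs , py

anyB-cong : {A : Set} {p q : A → Bool} (xs : List A) → (∀ {x} → x ∈ xs → p x ≡ q x) →
            anyB p xs ≡ anyB q xs
anyB-cong []       p≡q = refl
anyB-cong (x ∷ xs) p≡q = cong₂ _∨_ (p≡q (here refl)) (anyB-cong xs (p≡q ∘ there))

anyB-resp-↭ : {A : Set} (p : A → Bool) {xs ys : List A} → xs ↭ ys → anyB p xs ≡ anyB p ys
anyB-resp-↭ p xs↭ys = ⇔→≡ (mk⇔ (transport xs↭ys) (transport (↭-sym xs↭ys)))
  where
  transport : ∀ {xs ys} → xs ↭ ys → anyB p xs ≡ true → anyB p ys ≡ true
  transport {xs} xs↭ys any≡true with anyB⁻ p xs any≡true
  ... | x , x∈xs , px = anyB⁺ p (∈-resp-↭ xs↭ys x∈xs) px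

anyB-map : {A B : Set} (p : B → Bool) (f : A → B) (xs : List A) → anyB p (map f xs) ≡ anyB (p ∘ f) xs
anyB-map p f []       = refl
anyB-map p f (x ∷ xs) = cong (p (f x) ∨_) (anyB-map p f xs)

allB-not : {A : Set} (p : A → Bool) (xs : List A) → allB (not ∘ p) xs ≡ not (anyB p xs)
allB-not p []       = refl
allB-not p (x ∷ xs) with p x
... | true  = refl
... | false = allB-not p xs

countB-cong : {A : Set} {p q : A → Bool} (xs : List A) → (∀ {x} → x ∈ xs → p x ≡ q x) →
              countB p xs ≡ countB q xs
countB-cong []       p≡q = refl
countB-cong {p = p} {q} (x ∷ xs) p≡q with p x | q x | p≡q (here refl)
... | true  | .true  | refl = cong suc (countB-cong xs (p≡q ∘ there))
... | false | .false | refl = countB-cong xs (p≡q ∘ there)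

countB-map : {A B : Set} (p : B → Bool) (f : A → B) (xs : List A) → countB p (map f xs) ≡ countB (p ∘ f) xs
countB-map p f []       = refl
countB-map p f (x ∷ xs) with p (f x)
... | true  = cong suc (countB-map p f xs)
... | false = countB-map p f xs

countB-resp-↭ : {A : Set} (p : A → Bool) {xs ys : List A} → xs ↭ ys → countB p xs ≡ countB p ys
countB-resp-↭ p ↭.refl        = refl
countB-resp-↭ p (↭.prep x q) with p x
... | true  = cong suc (countB-resp-↭ p q)
... | false = countB-resp-↭ p q
countB-resp-↭ p (↭.swap x y q) with p x | p y
... | true  | true  = cong (suc ∘ suc) (countB-resp-↭ p q)
... | true  | false = cong suc (countB-resp-↭ p q)
... | false | true  = cong suc (countB-resp-↭ p q)
... | false | false = countB-resp-↭ p q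
countB-resp-↭ p (↭.trans q r) = ≡.trans (countB-resp-↭ p q) (countB-resp-↭ p r)

∧-≡true⁻ : ∀ {a b} → (a ∧ b) ≡ true → a ≡ true × b ≡ true
∧-≡true⁻ {true} {true} _ = refl , refl

≡ᵇ-≡true⇒≡ : ∀ {n} {u v : Fin n} → (toℕ u ≡ᵇ toℕ v) ≡ true → u ≡ v
≡ᵇ-≡true⇒≡ {u = u} {v} e = toℕ-injective (≡ᵇ⇒≡ (toℕ u) (toℕ v) (subst T (sym e) _))

≡ᵇ-refl : ∀ m → (m ≡ᵇ m) ≡ true
≡ᵇ-refl zero    = refl
≡ᵇ-refl (suc m) = ≡ᵇ-refl m

≡⇒≡ᵇ-≡true : ∀ {n} {u v : Fin n} → u ≡ v → (toℕ u ≡ᵇ toℕ v) ≡ true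
≡⇒≡ᵇ-≡true {u = u} refl = ≡ᵇ-refl (toℕ u)

<ᵇ-irrefl : ∀ m → (m <ᵇ m) ≡ false
<ᵇ-irrefl zero    = refl
<ᵇ-irrefl (suc m) = <ᵇ-irrefl m

<⇒<ᵇ≡true : ∀ {m n} → m < n → (m <ᵇ n) ≡ true
<⇒<ᵇ≡true {zero}  (s≤s _)   = refl
<⇒<ᵇ≡true {suc m} (s≤s m<n) = <⇒<ᵇ≡true m<n

≤⇒>ᵇ≡false : ∀ {m n} → n ≤ m → (m <ᵇ n) ≡ false
≤⇒>ᵇ≡false z≤n       = refl
≤⇒>ᵇ≡false (s≤s n≤m) = ≤⇒>ᵇ≡false n≤m

xor-cancelʳ : ∀ e e′ s → e xor s ≡ e′ xor s → e ≡ e′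
xor-cancelʳ true  true  s _  = refl
xor-cancelʳ false false s _  = refl
xor-cancelʳ true  false s eq = contradiction (sym eq) (not-¬ refl)
xor-cancelʳ false true  s eq = contradiction eq (not-¬ refl)

-- Counting the classes of an equivalence

covered : {X : Set} → (X → X → Bool) → List X → X → Bool
covered R seen x = anyB (λ y → R y x) seen

-- The greedy count performed by `countOrbits`, for an arbitrary relation. When `R` is an equivalence,
-- `countClasses R xs seen` is the number of classes that meet `xs` but not `seen`.
countClasses : {X : Set} → (X → X → Bool) → List X → List X → ℕ
countClasses R []       seen = 0
countClasses R (x ∷ xs) seen =
  if covered R seen x then countClasses R xs seen else suc (countClasses R xs (x ∷ seen))

countClasses-map : {X Y : Set} (R : X → X → Bool) (R′ : Y → Y → Bool) (φ : X → Y) →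
                   (∀ y x → R′ (φ y) (φ x) ≡ R y x) →
                   ∀ xs seen → countClasses R′ (map φ xs) (map φ seen) ≡ countClasses R xs seen
countClasses-map R R′ φ R′≡R [] seen = refl
countClasses-map R R′ φ R′≡R (x ∷ xs) seen
  rewrite ≡.trans (anyB-map (λ y → R′ y (φ x)) φ seen) (anyB-cong seen (λ {y} _ → R′≡R y x))
  with covered R seen x
... | true  = countClasses-map R R′ φ R′≡R xs seen
... | false = cong suc (countClasses-map R R′ φ R′≡R xs (x ∷ seen))

countClasses-cong : {X : Set} {R R′ : X → X → Bool} → (∀ y x → R y x ≡ R′ y x) →
                    ∀ xs seen → countClasses R xs seen ≡ countClasses R′ xs seen
countClasses-cong R≗R′ []       seen = refl
countClasses-cong {R = R} {R′} R≗R′ (x ∷ xs) seen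
  rewrite anyB-cong {p = λ y → R y x} {q = λ y → R′ y x} seen (λ {y} _ → R≗R′ y x)
  with covered R′ seen x
... | true  = countClasses-cong R≗R′ xs seen
... | false = cong suc (countClasses-cong R≗R′ xs (x ∷ seen))

module _ {X : Set} (R : X → X → Bool) (M : X → Set)
         (R-sym : ∀ {x y} → M x → M y → R x y ≡ true → R y x ≡ true)
         (R-trans : ∀ {x y z} → M x → M y → M z → R x y ≡ true → R y z ≡ true → R x z ≡ true)
         where

  countClasses-cong-seen : ∀ {s₁ s₂} xs → All M xs →
                           (∀ {z} → M z → covered R s₁ z ≡ covered R s₂ z) →
                           countClasses R xs s₁ ≡ countClasses R xs s₂
  countClasses-cong-seen [] _ _ = refl
  countClasses-cong-seen {s₁} {s₂} (x ∷ xs) (mx ∷ mxs) s₁≈s₂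
    with covered R s₁ x | covered R s₂ x | s₁≈s₂ mx
  ... | true  | .true  | refl = countClasses-cong-seen xs mxs s₁≈s₂
  ... | false | .false | refl = cong suc (countClasses-cong-seen xs mxs (cong (R x _ ∨_) ∘ s₁≈s₂))

  countClasses-swap : ∀ {x y zs zs′} seen → M x → M y → All M zs →
                      (∀ seen′ → countClasses R zs seen′ ≡ countClasses R zs′ seen′) →
                      countClasses R (x ∷ y ∷ zs) seen ≡ countClasses R (y ∷ x ∷ zs′) seen
  countClasses-swap {x} {y} {zs} seen mx my mzs zs≈zs′
    with covered R seen x | covered R seen y | R x y in xRy | R y x in yRx
  ... | true  | true  | _     | _     = zs≈zs′ seen
  ... | true  | false | _     | true  = cong suc (zs≈zs′ (y ∷ seen))
  ... | true  | false | _     | false = cong suc (zs≈zs′ (y ∷ seen))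
  ... | false | true  | true  | _     = cong suc (zs≈zs′ (x ∷ seen))
  ... | false | true  | false | _     = cong suc (zs≈zs′ (x ∷ seen))
  ... | false | false | true  | true  = cong suc (≡.trans (countClasses-cong-seen zs mzs λ mz →
        cong (_∨ covered R seen _) (⇔→≡ (mk⇔ (R-trans my mx mz yRx) (R-trans mx my mz xRy))))
        (zs≈zs′ (y ∷ seen)))
  ... | false | false | false | false = cong (suc ∘ suc) (≡.trans (countClasses-cong-seen zs mzs λ {z} _ →
        ∨-swap (R y z) (R x z) (covered R seen z)) (zs≈zs′ (x ∷ y ∷ seen)))
  ... | false | false | true  | false = contradiction (≡.trans (sym (R-sym mx my xRy)) yRx) λ ()
  ... | false | false | false | true  = contradiction (≡.trans (sym (R-sym my mx yRx)) xRy) λ ()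

  countClasses-resp-↭ : ∀ {xs ys} seen → xs ↭ ys → All M xs →
                        countClasses R xs seen ≡ countClasses R ys seen
  countClasses-resp-↭ seen ↭.refl _ = refl
  countClasses-resp-↭ seen (↭.prep x p) (mx ∷ mxs) with covered R seen x
  ... | true  = countClasses-resp-↭ seen p mxs
  ... | false = cong suc (countClasses-resp-↭ (x ∷ seen) p mxs)
  countClasses-resp-↭ seen (↭.swap {ys = ys} x y p) (mx ∷ my ∷ mxs) =
    countClasses-swap {zs′ = ys} seen mx my mxs (λ seen′ → countClasses-resp-↭ seen′ p mxs)
  countClasses-resp-↭ seen (↭.trans p q) mxs =
    ≡.trans (countClasses-resp-↭ seen p mxs) (countClasses-resp-↭ seen q (All-resp-↭ p mxs))

module _ {n : ℕ} (R : Fin n → Fin n → Bool)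
         (R-trans : ∀ {x y z} → R x y ≡ true → R y z ≡ true → R x z ≡ true) where

  relatedToEarlier : List (Fin n) → Fin n → Bool
  relatedToEarlier xs x = anyB (λ y → (toℕ y <ᵇ toℕ x) ∧ R y x) xs

  covered-trans : ∀ seen {x z} → covered R seen x ≡ true → R x z ≡ true → covered R seen z ≡ true
  covered-trans seen cx xRz with anyB⁻ _ seen cx
  ... | y , y∈seen , yRx = anyB⁺ _ y∈seen (R-trans yRx xRz)

  relatedToEarlier-minimum : ∀ {x xs} → All (x Fin.<_) xs → relatedToEarlier xs x ≡ false
  relatedToEarlier-minimum []            = refl
  relatedToEarlier-minimum (x<y ∷ x<xs) rewrite ≤⇒>ᵇ≡false (<⇒≤ x<y) = relatedToEarlier-minimum x<xs

  countClasses-increasing : ∀ {xs} → AllPairs Fin._<_ xs → ∀ seen →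
    countClasses R xs seen ≡ countB (λ x → not (covered R seen x ∨ relatedToEarlier xs x)) xs
  countClasses-increasing []                          seen = refl
  countClasses-increasing {x ∷ xs} (x<xs ∷ increasing) seen
    rewrite <ᵇ-irrefl (toℕ x) | relatedToEarlier-minimum x<xs
    with covered R seen x in cx
  ... | true  = ≡.trans (countClasses-increasing increasing seen) (countB-cong xs (cong not ∘ absorb))
    where
    absorb : ∀ {z} → z ∈ xs → covered R seen z ∨ relatedToEarlier xs z
                            ≡ covered R seen z ∨ (((toℕ x <ᵇ toℕ z) ∧ R x z) ∨ relatedToEarlier xs z)
    absorb {z} z∈xs rewrite <⇒<ᵇ≡true (All.lookup x<xs z∈xs) with R x z in xRz
    ... | true  rewrite covered-trans seen cx xRz = refl
    ... | false = refl
  ... | false = cong suc (≡.trans (countClasses-increasing increasing (x ∷ seen))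
                                  (countB-cong xs (cong not ∘ regroup)))
    where
    regroup : ∀ {z} → z ∈ xs → (R x z ∨ covered R seen z) ∨ relatedToEarlier xs z
                             ≡ covered R seen z ∨ (((toℕ x <ᵇ toℕ z) ∧ R x z) ∨ relatedToEarlier xs z)
    regroup {z} z∈xs rewrite <⇒<ᵇ≡true (All.lookup x<xs z∈xs) =
      ≡.trans (∨-assoc (R x z) (covered R seen z) _) (∨-swap (R x z) (covered R seen z) (relatedToEarlier xs z))

module _ {A : Set} (f : A → A) where
  open ≡.≡-Reasoning

  iter-+ : ∀ m k x → iter f (m + k) x ≡ iter f m (iter f k x)
  iter-+ zero    k x = refl
  iter-+ (suc m) k x = cong f (iter-+ m k x)

  iter-* : ∀ {p x} → iter f p x ≡ x → ∀ q → iter f (q * p) x ≡ x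
  iter-* {p} {x} fixed zero    = refl
  iter-* {p} {x} fixed (suc q) = begin
    iter f (p + q * p) x        ≡⟨ iter-+ p (q * p) x ⟩
    iter f p (iter f (q * p) x) ≡⟨ cong (iter f p) (iter-* fixed q) ⟩
    iter f p x                  ≡⟨ fixed ⟩
    x                           ∎

  iter-cong : ∀ {g : A → A} → (∀ x → f x ≡ g x) → ∀ k x → iter f k x ≡ iter g k x
  iter-cong     f≗g zero    x = refl
  iter-cong {g} f≗g (suc k) x = ≡.trans (f≗g _) (cong g (iter-cong f≗g k x))

  iter-commute : ∀ {B : Set} {g : B → B} (φ : A → B) → (∀ x → g (φ x) ≡ φ (f x)) →
                 ∀ k x → iter g k (φ x) ≡ φ (iter f k x)
  iter-commute         φ commute zero    x = refl
  iter-commute {g = g} φ commute (suc k) x =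
    ≡.trans (cong g (iter-commute φ commute k x)) (commute (iter f k x))

  module _ (L : List A) (closed : ∀ {x} → x ∈ L → f x ∈ L) where

    iter-∈ : ∀ {x} → x ∈ L → ∀ k → iter f k x ∈ L
    iter-∈ x∈L zero    = x∈L
    iter-∈ x∈L (suc k) = closed (iter-∈ x∈L k)

    iter-repeat : ∀ {x} → x ∈ L →
                  ∃₂ λ i p → i + suc p ≤ length L × iter f i x ≡ iter f (i + suc p) x
    iter-repeat {x} x∈L
      with i , j , i<j , same-index ← pigeonhole (n<1+n (length L)) (λ i → index (iter-∈ x∈L (toℕ i)))
      with p , i+1+p≡j ← m≤n⇒∃[o]m+o≡n i<j =
      toℕ i , p , ≡.subst (_≤ length L) (sym j≡) (≤-pred (toℕ<n j)) , (begin
        iter f (toℕ i) x                      ≡⟨ lookup-index (iter-∈ x∈L (toℕ i)) ⟩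
        lookup L (index (iter-∈ x∈L (toℕ i))) ≡⟨ cong (lookup L) same-index ⟩
        lookup L (index (iter-∈ x∈L (toℕ j))) ≡⟨ sym (lookup-index (iter-∈ x∈L (toℕ j))) ⟩
        iter f (toℕ j) x                      ≡⟨ cong (λ k → iter f k x) (sym j≡) ⟩
        iter f (toℕ i + suc p) x              ∎)
      where
      j≡ : toℕ i + suc p ≡ toℕ j
      j≡ = ≡.trans (+-suc (toℕ i) p) i+1+p≡j

    iter-shortcut : ∀ {x y} → x ∈ L → ∀ k → iter f k x ≡ y →
                    ∃ λ k′ → k′ < length L × iter f k′ x ≡ y
    iter-shortcut {x} {y} x∈L k = go k (<-wellFounded k)
      where
      go : ∀ k → Acc _<_ k → iter f k x ≡ y → ∃ λ k′ → k′ < length L × iter f k′ x ≡ y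
      go k (acc smaller) reaches with k <? length L
      ... | yes k<len = k , k<len , reaches
      ... | no  k≮len with i , p , j≤len , loop ← iter-repeat x∈L =
        go ((k ∸ j) + i) (smaller shorter) (begin
          iter f ((k ∸ j) + i) x        ≡⟨ iter-+ (k ∸ j) i x ⟩
          iter f (k ∸ j) (iter f i x)   ≡⟨ cong (iter f (k ∸ j)) loop ⟩
          iter f (k ∸ j) (iter f j x)   ≡⟨ sym (iter-+ (k ∸ j) j x) ⟩
          iter f ((k ∸ j) + j) x        ≡⟨ cong (λ m → iter f m x) (m∸n+n≡m j≤k) ⟩
          iter f k x                    ≡⟨ reaches ⟩
          y                             ∎)
        where
        j : ℕ
        j = i + suc p
        j≤k : j ≤ k
        j≤k = ≤-trans j≤len (≮⇒≥ k≮len)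
        shorter : (k ∸ j) + i < k
        shorter = <-≤-trans (+-monoʳ-< (k ∸ j) (m<m+n i (s≤s z≤n))) (≤-reflexive (m∸n+n≡m j≤k))

    module _ (injective : ∀ {x y} → x ∈ L → y ∈ L → f x ≡ f y → x ≡ y) where

      iter-injective : ∀ {x y} → x ∈ L → y ∈ L → ∀ k → iter f k x ≡ iter f k y → x ≡ y
      iter-injective x∈L y∈L zero    same = same
      iter-injective x∈L y∈L (suc k) same =
        iter-injective x∈L y∈L k (injective (iter-∈ x∈L k) (iter-∈ y∈L k) same)

      iter-period : ∀ {x} → x ∈ L → ∃ λ p → iter f (suc p) x ≡ x
      iter-period {x} x∈L with i , p , _ , loop ← iter-repeat x∈L =
        p , sym (iter-injective x∈L (iter-∈ x∈L (suc p)) i (≡.trans loop (iter-+ i (suc p) x)))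

-- Connectivity

module Connectivity (G : Graph) where

  Conn : ℕ → Fin (size G) → Fin (size G) → Set
  Conn k u v = conn G k u v ≡ true

  conn-refl : ∀ u → Conn 0 u u
  conn-refl u = ≡ᵇ-refl (toℕ u)

  conn-zero⁻ : ∀ u v → Conn 0 u v → u ≡ v
  conn-zero⁻ u v = ≡ᵇ-≡true⇒≡

  conn-suc : ∀ k u v → Conn k u v → Conn (suc k) u v
  conn-suc k u v c rewrite c = refl

  conn-mono : ∀ {k l} u v → k ≤ l → Conn k u v → Conn l u v
  conn-mono u v = go ∘′ ≤⇒≤′
    where
    go : ∀ {k l} → k ≤′ l → Conn k u v → Conn l u v
    go ≤′-refl                  c = c
    go (≤′-step {n = l} k≤l) c = conn-suc l u v (go k≤l c)

  conn-snoc : ∀ k u w v → Conn k u w → adj G w v ≡ true → Conn (suc k) u v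
  conn-snoc k u w v c a with conn G k u v
  ... | true  = refl
  ... | false = anyB⁺ (λ x → conn G k u x ∧ adj G x v) (∈-allFin w) (cong₂ _∧_ c a)

  conn-suc⁻ : ∀ k u v → Conn (suc k) u v → Conn k u v ⊎ ∃ λ w → Conn k u w × adj G w v ≡ true
  conn-suc⁻ k u v c with conn G k u v
  ... | true  = inj₁ refl
  ... | false with anyB⁻ (λ x → conn G k u x ∧ adj G x v) (allFin (size G)) c
  ...   | w , _ , cw = inj₂ (w , ∧-≡true⁻ cw)

  conn-cons : ∀ k u w v → adj G u w ≡ true → Conn k w v → Conn (suc k) u v
  conn-cons zero u w v a c with conn-zero⁻ w v c
  ... | refl = conn-snoc 0 u u w (conn-refl u) a
  conn-cons (suc k) u w v a c with conn-suc⁻ k w v c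
  ... | inj₁ c′            = conn-suc (suc k) u v (conn-cons k u w v a c′)
  ... | inj₂ (x , c′ , a′) = conn-snoc (suc k) u x v (conn-cons k u w x a c′) a′

  conn-sym : ∀ k u v → Conn k u v → Conn k v u
  conn-sym zero u v c with conn-zero⁻ u v c
  ... | refl = c
  conn-sym (suc k) u v c with conn-suc⁻ k u v c
  ... | inj₁ c′           = conn-suc k v u (conn-sym k u v c′)
  ... | inj₂ (w , c′ , a) = conn-cons k v w u (≡.trans (adj-sym G v w) a) (conn-sym k u w c′)

  conn-+ : ∀ k l u w v → Conn k u w → Conn l w v → Conn (l + k) u v
  conn-+ k zero u w v c d with conn-zero⁻ w v d
  ... | refl = c
  conn-+ k (suc l) u w v c d with conn-suc⁻ l w v d
  ... | inj₁ d′           = conn-suc (l + k) u v (conn-+ k l u w v c d′)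
  ... | inj₂ (x , d′ , a) = conn-snoc (l + k) u x v (conn-+ k l u w x c d′) a

  module Distance (u : Fin (size G)) where

    AtDistance : ℕ → Fin (size G) → Set
    AtDistance j x = Conn j u x × (∀ i → i < j → conn G i u x ≡ false)

    atDistance-unique : ∀ {i j x} → AtDistance i x → AtDistance j x → i ≡ j
    atDistance-unique {i} {j} (c , far) (c′ , far′) with <-cmp i j
    ... | tri< i<j _ _ = contradiction (≡.trans (sym c) (far′ i i<j)) λ ()
    ... | tri≈ _ i≡j _ = i≡j
    ... | tri> _ _ j<i = contradiction (≡.trans (sym c′) (far j j<i)) λ ()

    atDistance-pred : ∀ {j x} → AtDistance (suc j) x → ∃ (AtDistance j)
    atDistance-pred {j} {x} (c , far) with conn-suc⁻ j u x c
    ... | inj₁ c′           = contradiction (≡.trans (sym c′) (far j (n<1+n j))) λ ()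
    ... | inj₂ (w , c′ , a) = w , c′ , farW
      where
      farW : ∀ i → i < j → conn G i u w ≡ false
      farW i i<j with conn G i u w in cw
      ... | false = refl
      ... | true  = contradiction (≡.trans (sym (conn-snoc i u w x cw a)) (far (suc i) (s≤s i<j))) λ ()

    atDistance-below : ∀ {j x} → AtDistance j x → ∀ i → i ≤ j → ∃ (AtDistance i)
    atDistance-below {j} {x} d i i≤j with i ≟ℕ j
    ... | yes refl = x , d
    atDistance-below {suc j} d i i≤sj | no i≢sj =
      let w , d′ = atDistance-pred d in atDistance-below d′ i (≤-pred (≤∧≢⇒< i≤sj i≢sj))
    atDistance-below {zero} d zero z≤n | no 0≢0 = contradiction refl 0≢0

    -- The vertices met at distances 0, …, j are pairwise distinct.
    atDistance-< : ∀ {j x} → AtDistance j x → j < size G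
    atDistance-< {j} d = injective⇒≤ {f = layer} λ {a} {b} e →
      toℕ-injective (atDistance-unique (subst (AtDistance (toℕ a)) e (proj₂ (witness a))) (proj₂ (witness b)))
      where
      witness : (i : Fin (suc j)) → ∃ (AtDistance (toℕ i))
      witness i = atDistance-below d (toℕ i) (≤-pred (toℕ<n i))
      layer : Fin (suc j) → Fin (size G)
      layer i = proj₁ (witness i)

  conn-shorten : ∀ k u v → Conn k u v → Conn (size G) u v
  conn-shorten zero    u v c = conn-mono {0} {size G} u v z≤n c
  conn-shorten (suc k) u v c = byCases (conn G k u v) refl
    where
    byCases : ∀ b → conn G k u v ≡ b → Conn (size G) u v
    byCases true  c′ = conn-shorten k u v c′
    byCases false c′ = conn-mono {suc k} u v (<⇒≤ (Distance.atDistance-< u (c , far))) c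
      where
      far : ∀ i → i < suc k → conn G i u v ≡ false
      far i i<sk with conn G i u v in ci
      ... | false = refl
      ... | true  = contradiction (≡.trans (sym (conn-mono u v (≤-pred i<sk) ci)) c′) λ ()

  connected-trans : ∀ u w v → Conn (size G) u w → Conn (size G) w v → Conn (size G) u v
  connected-trans u w v c d = conn-shorten (size G + size G) u v (conn-+ (size G) (size G) u w v c d)

-- `numComponents` counts the vertices with no smaller vertex in their component; on the increasing
-- list `allFin` these are exactly the vertices kept by the greedy count.
numComponents≡countClasses : ∀ G → numComponents G ≡ countClasses (conn G (size G)) (allFin (size G)) []
numComponents≡countClasses G = ≡.trans
  (countB-cong (allFin (size G)) λ {x} _ →
     allB-not (λ y → (toℕ y <ᵇ toℕ x) ∧ conn G (size G) y x) (allFin (size G)))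
  (sym (countClasses-increasing (conn G (size G)) (λ {x} {y} {z} → connected-trans x y z) (tabulate⁺-< id) []))
  where open Connectivity G

-- Face tracing

overPairs : {X : Set} (n : ℕ) → (Fin n → Fin n → List X) → List X
overPairs n F = concatMap (λ u → concatMap (F u) (allFin n)) (allFin n)

concatL-overPairs : {X : Set} (n : ℕ) (F : Fin n → Fin n → List X) →
                    concatL (λ u → concatL (F u) (allFin n)) (allFin n) ≡ overPairs n F
concatL-overPairs n F = ≡.trans (concatL≡concatMap _ (allFin n))
                                (concatMap-cong (λ u → concatL≡concatMap (F u) (allFin n)) (allFin n))

∈-overPairs⁺ : {X : Set} {n : ℕ} (F : Fin n → Fin n → List X) {x : X} (u v : Fin n) →
               x ∈ F u v → x ∈ overPairs n F
∈-overPairs⁺ F u v x∈F =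
  ∈-concatMap⁺ (λ u → concatMap (F u) (allFin _))
    (Any.map (λ { refl → ∈-concatMap⁺ (F u) (Any.map (λ { refl → x∈F }) (∈-allFin v)) }) (∈-allFin u))

∈-overPairs⁻ : {X : Set} {n : ℕ} (F : Fin n → Fin n → List X) {x : X} →
               x ∈ overPairs n F → ∃₂ λ u v → x ∈ F u v
∈-overPairs⁻ {n = n} F x∈
  with u , x∈u ← Any.satisfied (∈-concatMap⁻ (λ u → concatMap (F u) (allFin n)) {allFin n} x∈)
  with v , x∈uv ← Any.satisfied (∈-concatMap⁻ (F u) {allFin n} x∈u) = u , v , x∈uv

flagsAt : (G : Graph) → Fin (size G) → Fin (size G) → List (Flag G)
flagsAt G u v = if adj G u v then (u , v , true) ∷ (u , v , false) ∷ [] else []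

flags≡overPairs : (G : Graph) → flags G ≡ overPairs (size G) (flagsAt G)
flags≡overPairs G = concatL-overPairs (size G) (flagsAt G)

dartsAt : (G : Graph) → Fin (size G) → Fin (size G) → List (Fin (size G))
dartsAt G u v = if adj G u v then u ∷ [] else []

numDarts≡overPairs : (G : Graph) → numDarts G ≡ length (overPairs (size G) (dartsAt G))
numDarts≡overPairs G = cong length (concatL-overPairs (size G) (dartsAt G))

∈-flagsAt : ∀ {G : Graph} {u v} e → adj G u v ≡ true → (u , v , e) ∈ flagsAt G u v
∈-flagsAt true  uv rewrite uv = here refl
∈-flagsAt false uv rewrite uv = there (here refl)

∈-flags⁺ : ∀ (G : Graph) {u v} e → adj G u v ≡ true → (u , v , e) ∈ flags G
∈-flags⁺ G {u} {v} e uv =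
  subst ((u , v , e) ∈_) (sym (flags≡overPairs G)) (∈-overPairs⁺ (flagsAt G) u v (∈-flagsAt {G} e uv))

∈-flags⁻ : ∀ (G : Graph) {u v e} → (u , v , e) ∈ flags G → adj G u v ≡ true
∈-flags⁻ G x∈ with ∈-overPairs⁻ (flagsAt G) (subst (_ ∈_) (flags≡overPairs G) x∈)
... | u , v , x∈uv with adj G u v in uv | x∈uv
...   | true | here refl         = uv
...   | true | there (here refl) = uv

∈-flags⁻-reverse : ∀ (G : Graph) {u v e} → (u , v , e) ∈ flags G → adj G v u ≡ true
∈-flags⁻-reverse G {u} {v} x∈ = ≡.trans (adj-sym G v u) (∈-flags⁻ G x∈)

flagEq-sound : ∀ {G : Graph} (x y : Flag G) → flagEq {G} x y ≡ true → x ≡ y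
flagEq-sound (u , v , e) (u′ , v′ , e′) same
  with uu , vv-ee ← ∧-≡true⁻ {toℕ u ≡ᵇ toℕ u′} same
  with vv , ee ← ∧-≡true⁻ {toℕ v ≡ᵇ toℕ v′} vv-ee
  with refl ← ≡ᵇ-≡true⇒≡ {u = u} {u′} uu | refl ← ≡ᵇ-≡true⇒≡ {u = v} {v′} vv
  with e | e′ | ee
... | true  | true  | _ = refl
... | false | false | _ = refl

flagEq-refl : ∀ {G : Graph} (x : Flag G) → flagEq {G} x x ≡ true
flagEq-refl (u , v , e) rewrite ≡ᵇ-refl (toℕ u) | ≡ᵇ-refl (toℕ v) with e
... | true  = refl
... | false = refl

module FaceTracing {G : Graph} (S : Scheme G) where
  open Scheme S
  open ≡.≡-Reasoning

  N : ℕ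
  N = length (flags G)

  turn : Bool → Fin (size G) → Fin (size G) → Fin (size G)
  turn c v u = if c then succ v u else pred v u

  turn-injective : ∀ c {v u u′} → adj G v u ≡ true → adj G v u′ ≡ true →
                   turn c v u ≡ turn c v u′ → u ≡ u′
  turn-injective true  {v} {u} {u′} vu vu′ same =
    ≡.trans (sym (pred-succ v u vu)) (≡.trans (cong (pred v) same) (pred-succ v u′ vu′))
  turn-injective false {v} {u} {u′} vu vu′ same =
    ≡.trans (sym (succ-pred v u vu)) (≡.trans (cong (succ v) same) (succ-pred v u′ vu′))

  step-∈-flags : ∀ {x} → x ∈ flags G → step S x ∈ flags G
  step-∈-flags {u , v , e} x∈ with e xor sig u v
  ... | true  = ∈-flags⁺ G true  (succ-nbr v u (∈-flags⁻-reverse G x∈))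
  ... | false = ∈-flags⁺ G false (pred-nbr v u (∈-flags⁻-reverse G x∈))

  step-injective : ∀ {x y} → x ∈ flags G → y ∈ flags G → step S x ≡ step S y → x ≡ y
  step-injective {u , v , e} {u′ , v′ , e′} x∈ y∈ same
    with refl ← cong proj₁ same
    with c≡c′ ← cong (proj₂ ∘ proj₂) same
    with refl ← turn-injective (e xor sig u v) (∈-flags⁻-reverse G x∈) (∈-flags⁻-reverse G y∈)
                  (≡.trans (cong (proj₁ ∘ proj₂) same) (cong (λ c → turn c v u′) (sym c≡c′)))
    = cong (λ e → u , v , e) (xor-cancelʳ e e′ (sig u v) c≡c′)

  inOrbit⇒iter : ∀ m y x → inOrbit S m y x ≡ true → ∃ λ k → iter (step S) k y ≡ x
  inOrbit⇒iter m y x inOrbit≡true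
    with k , _ , eq ← anyB⁻ (λ k → flagEq {G} (iter (step S) k y) x) (upTo m) inOrbit≡true =
    k , flagEq-sound {G} (iter (step S) k y) x eq

  -- `inOrbit` only tries the first |flags G| steps, which suffices by `iter-shortcut`.
  iter⇒inOrbit : ∀ {y} k → y ∈ flags G → inOrbit S N y (iter (step S) k y) ≡ true
  iter⇒inOrbit {y} k y∈ with k′ , k′<N , eq ← iter-shortcut (step S) (flags G) step-∈-flags y∈ k refl =
    anyB⁺ (λ i → flagEq {G} (iter (step S) i y) (iter (step S) k y)) (∈-upTo⁺ k′<N)
          (subst (λ z → flagEq {G} z (iter (step S) k y) ≡ true) (sym eq) (flagEq-refl {G} (iter (step S) k y)))

  inOrbit-sym : ∀ {x y} → x ∈ flags G → y ∈ flags G →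
                inOrbit S N x y ≡ true → inOrbit S N y x ≡ true
  inOrbit-sym {x} {y} x∈ y∈ x~y
    with k , refl ← inOrbit⇒iter N x y x~y
    with p , period ← iter-period (step S) (flags G) step-∈-flags step-injective x∈ =
    subst (λ z → inOrbit S N (iter (step S) k x) z ≡ true) back (iter⇒inOrbit (k * p) y∈)
    where
    k*p+k≡k*suc[p] : k * p + k ≡ k * suc p
    k*p+k≡k*suc[p] = ≡.trans (+-comm (k * p) k) (sym (*-suc k p))
    back : iter (step S) (k * p) (iter (step S) k x) ≡ x
    back = begin
      iter (step S) (k * p) (iter (step S) k x) ≡⟨ sym (iter-+ (step S) (k * p) k x) ⟩
      iter (step S) (k * p + k) x               ≡⟨ cong (λ m → iter (step S) m x) k*p+k≡k*suc[p] ⟩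
      iter (step S) (k * suc p) x               ≡⟨ iter-* (step S) period k ⟩
      x                                        ∎

  inOrbit-trans : ∀ {x y z} → x ∈ flags G → y ∈ flags G → z ∈ flags G →
                  inOrbit S N x y ≡ true → inOrbit S N y z ≡ true →
                  inOrbit S N x z ≡ true
  inOrbit-trans {x} {y} {z} x∈ _ _ x~y y~z
    with k , refl ← inOrbit⇒iter N x y x~y
    with l , refl ← inOrbit⇒iter N y z y~z =
    subst (λ w → inOrbit S N x w ≡ true) (iter-+ (step S) l k x) (iter⇒inOrbit (l + k) x∈)

  orbits≡countClasses : orbits S ≡ countClasses (inOrbit S N) (flags G) []
  orbits≡countClasses = go (flags G) []
    where
    go : ∀ xs seen → countOrbits S N xs seen ≡ countClasses (inOrbit S N) xs seen
    go []       seen = refl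
    go (x ∷ xs) seen with anyB (λ y → inOrbit S N y x) seen
    ... | true  = go xs seen
    ... | false = cong suc (go xs (x ∷ seen))

orbits-cong : ∀ {G : Graph} (S S′ : Scheme G) →
              (∀ v u → Scheme.succ S v u ≡ Scheme.succ S′ v u) →
              (∀ v u → Scheme.pred S v u ≡ Scheme.pred S′ v u) →
              (∀ u v → Scheme.sig S u v ≡ Scheme.sig S′ u v) → orbits S ≡ orbits S′
orbits-cong {G} S S′ succ≡ pred≡ sig≡ = begin
  orbits S                                                  ≡⟨ FaceTracing.orbits≡countClasses S ⟩
  countClasses (inOrbit S (length (flags G))) (flags G) []  ≡⟨ countClasses-cong inOrbit≡ (flags G) [] ⟩
  countClasses (inOrbit S′ (length (flags G))) (flags G) [] ≡⟨ sym (FaceTracing.orbits≡countClasses S′) ⟩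
  orbits S′                                                 ∎
  where
  open ≡.≡-Reasoning
  step≡ : ∀ x → step S x ≡ step S′ x
  step≡ (u , v , e) rewrite sig≡ u v | succ≡ v u | pred≡ v u = refl
  inOrbit≡ : ∀ y x → inOrbit S (length (flags G)) y x ≡ inOrbit S′ (length (flags G)) y x
  inOrbit≡ y x = anyB-cong (upTo (length (flags G))) λ {k} _ →
    cong (λ z → flagEq {G} z x) (iter-cong (step S) step≡ k y)

-- Invariance under isomorphism

module Isomorphism {G H : Graph} (I : G ≅ H) where

  open Inverse (⤖⇒↔ (proj₁ I)) public
    using (to; from) renaming (strictlyInverseˡ to to∘from; strictlyInverseʳ to from∘to)

  to-injective : ∀ {u v} → to u ≡ to v → u ≡ v
  to-injective = Bijection.injective (proj₁ I)

  from-injective : ∀ {u v} → from u ≡ from v → u ≡ v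
  from-injective {u} {v} eq = ≡.trans (sym (to∘from u)) (≡.trans (cong to eq) (to∘from v))

  adj-to : ∀ u v → adj H (to u) (to v) ≡ adj G u v
  adj-to = proj₂ I

  adj-from : ∀ u v → adj G (from u) (from v) ≡ adj H u v
  adj-from u v = ≡.trans (sym (adj-to (from u) (from v))) (cong₂ (adj H) (to∘from u) (to∘from v))

  size≡ : size G ≡ size H
  size≡ = ≤-antisym (injective⇒≤ to-injective) (injective⇒≤ from-injective)

  allFin-↭ : allFin (size H) ↭ map to (allFin (size G))
  allFin-↭ = ∼bag⇒↭ (unique∧set⇒bag (allFin⁺ (size H)) (Unique-map⁺ to-injective (allFin⁺ (size G)))
    λ {v} → mk⇔ (λ _ → subst (_∈ map to (allFin (size G))) (to∘from v) (∈-map⁺ to (∈-allFin (from v))))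
                (λ _ → ∈-allFin v))

  concatMap-allFin-↭ : {X Y : Set} (F : Fin (size H) → List X) (E : Fin (size G) → List Y) (h : Y → X) →
                       (∀ u → F (to u) ↭ map h (E u)) →
                       concatMap F (allFin (size H)) ↭ map h (concatMap E (allFin (size G)))
  concatMap-allFin-↭ F E h F∘to↭ = begin
    concatMap F (allFin (size H))           ↭⟨ concatMap⁺ F allFin-↭ ⟩
    concatMap F (map to (allFin (size G)))  ≡⟨ concatMap-map F to (allFin (size G)) ⟩
    concatMap (F ∘ to) (allFin (size G))    ↭⟨ concatMap-↭-pointwise (allFin (size G)) F∘to↭ ⟩
    concatMap (map h ∘ E) (allFin (size G)) ≡⟨ sym (map-concatMap h E (allFin (size G))) ⟩
    map h (concatMap E (allFin (size G)))   ∎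
    where open PermutationReasoning

  overPairs-↭ : {X Y : Set} (F : Fin (size H) → Fin (size H) → List X)
                (E : Fin (size G) → Fin (size G) → List Y) (h : Y → X) →
                (∀ u v → F (to u) (to v) ≡ map h (E u v)) →
                overPairs (size H) F ↭ map h (overPairs (size G) E)
  overPairs-↭ F E h F∘to≡ =
    concatMap-allFin-↭ _ _ h (λ u → concatMap-allFin-↭ (F (to u)) (E u) h (λ v → ↭-reflexive (F∘to≡ u v)))

  anyB-allFin : (p : Fin (size H) → Bool) → anyB p (allFin (size H)) ≡ anyB (p ∘ to) (allFin (size G))
  anyB-allFin p = ≡.trans (anyB-resp-↭ p allFin-↭) (anyB-map p to (allFin (size G)))

  countB-allFin : (p : Fin (size H) → Bool) → countB p (allFin (size H)) ≡ countB (p ∘ to) (allFin (size G))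
  countB-allFin p = ≡.trans (countB-resp-↭ p allFin-↭) (countB-map p to (allFin (size G)))

  dartsAt-to : ∀ u v → dartsAt H (to u) (to v) ≡ map to (dartsAt G u v)
  dartsAt-to u v rewrite adj-to u v with adj G u v
  ... | true  = refl
  ... | false = refl

  numDarts-≅ : numDarts G ≡ numDarts H
  numDarts-≅ = begin
    numDarts G                                        ≡⟨ numDarts≡overPairs G ⟩
    length (overPairs (size G) (dartsAt G))           ≡⟨ sym (length-map to (overPairs (size G) (dartsAt G))) ⟩
    length (map to (overPairs (size G) (dartsAt G)))  ≡⟨ sym (↭-length darts-↭) ⟩
    length (overPairs (size H) (dartsAt H))           ≡⟨ sym (numDarts≡overPairs H) ⟩
    numDarts H                                        ∎
    where
    open ≡.≡-Reasoning
    darts-↭ : overPairs (size H) (dartsAt H) ↭ map to (overPairs (size G) (dartsAt G))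
    darts-↭ = overPairs-↭ (dartsAt H) (dartsAt G) to dartsAt-to

  numIsolated-≅ : numIsolated G ≡ numIsolated H
  numIsolated-≅ = sym (≡.trans (countB-allFin _) (countB-cong (allFin (size G)) λ {v} _ →
    cong not (≡.trans (anyB-allFin (adj H (to v))) (anyB-cong (allFin (size G)) λ {w} _ → adj-to v w))))

  conn-to : ∀ k u v → conn H k (to u) (to v) ≡ conn G k u v
  conn-to zero    u v =
    ⇔→≡ (mk⇔ (≡⇒≡ᵇ-≡true ∘ to-injective ∘ ≡ᵇ-≡true⇒≡) (≡⇒≡ᵇ-≡true ∘ cong to ∘ ≡ᵇ-≡true⇒≡))
  conn-to (suc k) u v = cong₂ _∨_ (conn-to k u v) (≡.trans (anyB-allFin _)
    (anyB-cong (allFin (size G)) λ {w} _ → cong₂ _∧_ (conn-to k u w) (adj-to w v)))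

  numComponents-≅ : numComponents G ≡ numComponents H
  numComponents-≅ = begin
    numComponents G                                              ≡⟨ numComponents≡countClasses G ⟩
    countClasses (conn G (size G)) (allFin (size G)) []          ≡⟨ sym renamed ⟩
    countClasses (conn H (size H)) (map to (allFin (size G))) [] ≡⟨ sym permuted ⟩
    countClasses (conn H (size H)) (allFin (size H)) []          ≡⟨ sym (numComponents≡countClasses H) ⟩
    numComponents H                                              ∎
    where
    open ≡.≡-Reasoning
    open Connectivity H
    connected-to : ∀ u v → conn H (size H) (to u) (to v) ≡ conn G (size G) u v
    connected-to u v = ≡.trans (conn-to (size H) u v) (cong (λ n → conn G n u v) (sym size≡))
    renamed : countClasses (conn H (size H)) (map to (allFin (size G))) [] ≡
              countClasses (conn G (size G)) (allFin (size G)) []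
    renamed = countClasses-map _ _ to connected-to (allFin (size G)) []
    permuted : countClasses (conn H (size H)) (allFin (size H)) [] ≡
               countClasses (conn H (size H)) (map to (allFin (size G))) []
    permuted = countClasses-resp-↭ (conn H (size H)) (λ _ → ⊤) (λ {x} {y} _ _ → conn-sym (size H) x y)
                 (λ {x} {y} {z} _ _ _ → connected-trans x y z) [] allFin-↭ (All.universal _ _)

  adj-from-to : ∀ v w → adj H v (to w) ≡ adj G (from v) w
  adj-from-to v w = ≡.trans (cong (λ v′ → adj H v′ (to w)) (sym (to∘from v))) (adj-to (from v) w)

  module _ (S : Scheme G) where
    open Scheme S

    transportScheme : Scheme H
    transportScheme = record
      { succ      = succ′
      ; pred      = λ v u → to (pred (from v) (from u))
      ; succ-nbr  = λ v u vu → ≡.trans (adj-from-to v _) (succ-nbr (from v) (from u) (adjG vu))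
      ; pred-nbr  = λ v u vu → ≡.trans (adj-from-to v _) (pred-nbr (from v) (from u) (adjG vu))
      ; pred-succ = λ v u vu → ≡.trans (cong (to ∘ pred (from v)) (from∘to _))
                                       (≡.trans (cong to (pred-succ (from v) (from u) (adjG vu))) (to∘from u))
      ; succ-pred = λ v u vu → ≡.trans (cong (to ∘ succ (from v)) (from∘to _))
                                       (≡.trans (cong to (succ-pred (from v) (from u) (adjG vu))) (to∘from u))
      ; cyclic    = cyclic′
      ; sig       = λ u v → sig (from u) (from v)
      ; sig-sym   = λ u v → sig-sym (from u) (from v)
      }
      where
      succ′ : Fin (size H) → Fin (size H) → Fin (size H)
      succ′ v u = to (succ (from v) (from u))

      adjG : ∀ {v u} → adj H v u ≡ true → adj G (from v) (from u) ≡ true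
      adjG {v} {u} = ≡.trans (adj-from v u)

      cyclic′ : ∀ v u w → adj H v u ≡ true → adj H v w ≡ true → ∃ λ k → iter (succ′ v) k u ≡ w
      cyclic′ v u w vu vw with k , reaches ← cyclic (from v) (from u) (from w) (adjG vu) (adjG vw) = k , (begin
        iter (succ′ v) k u                    ≡⟨ cong (iter (succ′ v) k) (sym (to∘from u)) ⟩
        iter (succ′ v) k (to (from u))        ≡⟨ iter-commute (succ (from v)) to succ′-to k (from u) ⟩
        to (iter (succ (from v)) k (from u))  ≡⟨ cong to reaches ⟩
        to (from w)                           ≡⟨ to∘from w ⟩
        w                                     ∎)
        where
        open ≡.≡-Reasoning
        succ′-to : ∀ x → succ′ v (to x) ≡ to (succ (from v) x)
        succ′-to x = cong (to ∘ succ (from v)) (from∘to x)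

    toFlag : Flag G → Flag H
    toFlag (u , v , e) = to u , to v , e

    toFlag-injective : ∀ {x y} → toFlag x ≡ toFlag y → x ≡ y
    toFlag-injective {u , v , e} {u′ , v′ , e′} eq
      with refl ← to-injective (cong proj₁ eq) | refl ← to-injective (cong (proj₁ ∘ proj₂) eq)
      with refl ← cong (proj₂ ∘ proj₂) eq = refl

    step-toFlag : ∀ x → step transportScheme (toFlag x) ≡ toFlag (step S x)
    step-toFlag (u , v , e) rewrite from∘to u | from∘to v with e xor sig u v
    ... | true  = refl
    ... | false = refl

    flagEq-toFlag : ∀ x y → flagEq {H} (toFlag x) (toFlag y) ≡ flagEq {G} x y
    flagEq-toFlag x y = ⇔→≡ (mk⇔
      (λ same → ≡.subst (λ z → flagEq {G} x z ≡ true)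
                        (toFlag-injective (flagEq-sound {H} (toFlag x) (toFlag y) same)) (flagEq-refl {G} x))
      (λ same → ≡.subst (λ z → flagEq {H} (toFlag x) z ≡ true) (cong toFlag (flagEq-sound {G} x y same))
                        (flagEq-refl {H} (toFlag x))))

    inOrbit-toFlag : ∀ m y x → inOrbit transportScheme m (toFlag y) (toFlag x) ≡ inOrbit S m y x
    inOrbit-toFlag m y x = anyB-cong (upTo m) λ {k} _ →
      ≡.trans (cong (λ z → flagEq {H} z (toFlag x)) (iter-commute (step S) toFlag step-toFlag k y))
              (flagEq-toFlag (iter (step S) k y) x)

    flagsAt-to : ∀ u v → flagsAt H (to u) (to v) ≡ map toFlag (flagsAt G u v)
    flagsAt-to u v rewrite adj-to u v with adj G u v
    ... | true  = refl
    ... | false = refl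

    flags-↭ : flags H ↭ map toFlag (flags G)
    flags-↭ = subst₂ _↭_ (sym (flags≡overPairs H)) (cong (map toFlag) (sym (flags≡overPairs G)))
                     (overPairs-↭ (flagsAt H) (flagsAt G) toFlag flagsAt-to)

    orbits-transportScheme : orbits transportScheme ≡ orbits S
    orbits-transportScheme = begin
      orbits S′                                   ≡⟨ H.orbits≡countClasses ⟩
      countClasses (inOrbit S′ H.N) (flags H) []  ≡⟨ permuted ⟩
      countClasses (inOrbit S′ H.N) φG []         ≡⟨ cong (λ m → countClasses (inOrbit S′ m) φG []) N≡ ⟩
      countClasses (inOrbit S′ G.N) φG []         ≡⟨ renamed ⟩
      countClasses (inOrbit S G.N) (flags G) []   ≡⟨ sym G.orbits≡countClasses ⟩
      orbits S                                    ∎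
      where
      open ≡.≡-Reasoning
      S′ : Scheme H
      S′ = transportScheme
      module H = FaceTracing S′
      module G = FaceTracing S
      φG : List (Flag H)
      φG = map toFlag (flags G)
      N≡ : length (flags H) ≡ length (flags G)
      N≡ = ≡.trans (↭-length flags-↭) (length-map toFlag (flags G))
      permuted : countClasses (inOrbit S′ H.N) (flags H) [] ≡ countClasses (inOrbit S′ H.N) φG []
      permuted = countClasses-resp-↭ _ (_∈ flags H) H.inOrbit-sym H.inOrbit-trans [] flags-↭ (All.tabulate id)
      renamed : countClasses (inOrbit S′ G.N) φG [] ≡ countClasses (inOrbit S G.N) (flags G) []
      renamed = countClasses-map _ _ toFlag (inOrbit-toFlag G.N) (flags G) []

≅-sym : ∀ {G H} → G ≅ H → H ≅ G
≅-sym {G} {H} I = ⤖-sym (proj₁ I) , adj-from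
  where open Isomorphism {G} {H} I

eulerBound-cong : ∀ {h c d v o i c′ d′ v′ o′ i′} →
                  c ≡ c′ → d ≡ d′ → v ≡ v′ → o ≡ o′ → i ≡ i′ →
                  4 * c + d ≤ 2 * h + 2 * v + o + 2 * i → 4 * c′ + d′ ≤ 2 * h + 2 * v′ + o′ + 2 * i′
eulerBound-cong refl refl refl refl refl bound = bound

EulerGenus≤-resp-≅ : ∀ {h G H} → G ≅ H → EulerGenus≤ h G → EulerGenus≤ h H
EulerGenus≤-resp-≅ {h} {G} {H} I (S , bound) = transportScheme S ,
  eulerBound-cong {h} numComponents-≅ numDarts-≅ size≡ (sym (orbits-transportScheme S)) numIsolated-≅ bound
  where open Isomorphism {G} {H} I

EulerGenus≤-mono : ∀ {h h′ G} → h ≤ h′ → EulerGenus≤ h G → EulerGenus≤ h′ G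
EulerGenus≤-mono h≤h′ (S , bound) =
  S , ≤-trans bound (+-monoˡ-≤ _ (+-monoˡ-≤ _ (+-monoˡ-≤ _ (*-monoʳ-≤ 2 h≤h′))))

-- Deciding Euler genus

functions : {A : Set} → List A → (k : ℕ) → List (Vector A k)
functions xs zero    = (λ ()) ∷ []
functions xs (suc k) = concatMap (λ a → map (a ◂_) (functions xs k)) xs

functions-complete : {A : Set} {xs : List A} (k : ℕ) (f : Vector A k) → (∀ i → f i ∈ xs) →
                     ∃ λ f′ → f′ ∈ functions xs k × (∀ i → f′ i ≡ f i)
functions-complete zero    f f∈ = (λ ()) , here refl , λ ()
functions-complete {xs = xs} (suc k) f f∈
  with f′ , f′∈ , f′≗f ← functions-complete k (f ∘ Fin.suc) (f∈ ∘ Fin.suc) =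
  f Fin.zero ◂ f′ ,
  ∈-concatMap⁺ (λ a → map (a ◂_) (functions xs k))
               (Any.map (λ { refl → ∈-map⁺ (f Fin.zero ◂_) f′∈ }) (f∈ Fin.zero)) ,
  λ { Fin.zero → refl ; (Fin.suc i) → f′≗f i }

functions₂ : {A : Set} → List A → (n : ℕ) → List (Fin n → Fin n → A)
functions₂ xs n = functions (functions xs n) n

functions₂-complete : {A : Set} {xs : List A} (n : ℕ) (f : Fin n → Fin n → A) → (∀ i j → f i j ∈ xs) →
                      ∃ λ f′ → f′ ∈ functions₂ xs n × (∀ i j → f′ i j ≡ f i j)
functions₂-complete n f f∈
  with rows ← (λ i → functions-complete n (f i) (f∈ i))
  with f′ , f′∈ , f′≗rows ← functions-complete n (proj₁ ∘ rows) (proj₁ ∘ proj₂ ∘ rows) =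
  f′ , f′∈ , λ i j → ≡.trans (cong (λ r → r j) (f′≗rows i)) (proj₂ (proj₂ (rows i)) j)

booleans : List Bool
booleans = true ∷ false ∷ []

∈-booleans : ∀ b → b ∈ booleans
∈-booleans true  = here refl
∈-booleans false = there (here refl)

SchemeData : ℕ → Set
SchemeData n = Fin n → Fin n → Fin n × Fin n × Bool

module _ {n : ℕ} (d : SchemeData n) where

  succᵈ predᵈ : Fin n → Fin n → Fin n
  succᵈ v u = proj₁ (d v u)
  predᵈ v u = proj₁ (proj₂ (d v u))

  sigᵈ : Fin n → Fin n → Bool
  sigᵈ u v = proj₂ (proj₂ (d u v))

-- As `Scheme`, but with the cyclicity witness bounded by the order so that every condition is decidable.
record IsSchemeData (G : Graph) (d : SchemeData (size G)) : Set where
  constructor isSchemeData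
  field
    succ-nbr  : ∀ v u → adj G v u ≡ true → adj G v (succᵈ d v u) ≡ true
    pred-nbr  : ∀ v u → adj G v u ≡ true → adj G v (predᵈ d v u) ≡ true
    pred-succ : ∀ v u → adj G v u ≡ true → predᵈ d v (succᵈ d v u) ≡ u
    succ-pred : ∀ v u → adj G v u ≡ true → succᵈ d v (predᵈ d v u) ≡ u
    cyclic    : ∀ v u w → adj G v u ≡ true → adj G v w ≡ true →
                ∃ λ (k : Fin (size G)) → iter (succᵈ d v) (toℕ k) u ≡ w
    sig-sym   : ∀ u v → sigᵈ d u v ≡ sigᵈ d v u

isSchemeData? : (G : Graph) (d : SchemeData (size G)) → Dec (IsSchemeData G d)
isSchemeData? G d = map′ (λ (a , b , c , d , e , f) → isSchemeData a b c d e f)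
                         (λ (isSchemeData a b c d e f) → a , b , c , d , e , f) (
  all? (λ v → all? λ u → adj? v u →-dec (adj G v (succᵈ d v u) ≟ᵇ true)) ×-dec
  all? (λ v → all? λ u → adj? v u →-dec (adj G v (predᵈ d v u) ≟ᵇ true)) ×-dec
  all? (λ v → all? λ u → adj? v u →-dec (predᵈ d v (succᵈ d v u) ≟ᶠ u)) ×-dec
  all? (λ v → all? λ u → adj? v u →-dec (succᵈ d v (predᵈ d v u) ≟ᶠ u)) ×-dec
  all? (λ v → all? λ u → all? λ w →
          adj? v u →-dec (adj? v w →-dec any? λ k → iter (succᵈ d v) (toℕ k) u ≟ᶠ w)) ×-dec
  all? (λ u → all? λ v → sigᵈ d u v ≟ᵇ sigᵈ d v u))
  where
  adj? : ∀ v u → Dec (adj G v u ≡ true)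
  adj? v u = adj G v u ≟ᵇ true

toScheme : ∀ {G d} → IsSchemeData G d → Scheme G
toScheme {d = d} isS = record
  { succ = succᵈ d ; pred = predᵈ d ; sig = sigᵈ d
  ; succ-nbr = succ-nbr ; pred-nbr = pred-nbr ; pred-succ = pred-succ ; succ-pred = succ-pred
  ; cyclic = λ v u w vu vw → let k , reaches = cyclic v u w vu vw in toℕ k , reaches
  ; sig-sym = sig-sym }
  where open IsSchemeData isS

schemeData : ∀ {G} → Scheme G → SchemeData (size G)
schemeData S v u = Scheme.succ S v u , Scheme.pred S v u , Scheme.sig S v u

schemeData-isSchemeData : ∀ {G} (S : Scheme G) → IsSchemeData G (schemeData S)
schemeData-isSchemeData {G} S = isSchemeData succ-nbr pred-nbr pred-succ succ-pred cyclic′ sig-sym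
  where
  open Scheme S
  cyclic′ : ∀ v u w → adj G v u ≡ true → adj G v w ≡ true →
            ∃ λ (k : Fin (size G)) → iter (succ v) (toℕ k) u ≡ w
  cyclic′ v u w vu vw
    with k , reaches ← cyclic v u w vu vw
    with k′ , k′<len , reaches′ ←
           iter-shortcut (succ v) (allFin (size G)) (λ _ → ∈-allFin _) (∈-allFin u) k reaches =
    fromℕ< k′<n , ≡.trans (cong (λ m → iter (succ v) m u) (toℕ-fromℕ< k′<n)) reaches′
    where
    k′<n : k′ < size G
    k′<n = ≡.subst (k′ <_) (length-tabulate (λ i → i)) k′<len

IsSchemeData-resp : ∀ {G} {d d′ : SchemeData (size G)} → (∀ v u → d v u ≡ d′ v u) →
                    IsSchemeData G d → IsSchemeData G d′
IsSchemeData-resp {G} {d} {d′} d≗d′ isS = record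
  { succ-nbr  = λ v u vu → subst (λ t → adj G v t ≡ true) (succ≡ v u) (succ-nbr v u vu)
  ; pred-nbr  = λ v u vu → subst (λ t → adj G v t ≡ true) (pred≡ v u) (pred-nbr v u vu)
  ; pred-succ = λ v u vu →
      ≡.trans (sym (pred≡ v _)) (≡.trans (cong (predᵈ d v) (sym (succ≡ v u))) (pred-succ v u vu))
  ; succ-pred = λ v u vu →
      ≡.trans (sym (succ≡ v _)) (≡.trans (cong (succᵈ d v) (sym (pred≡ v u))) (succ-pred v u vu))
  ; cyclic    = λ v u w vu vw → let k , reaches = cyclic v u w vu vw in
                  k , ≡.trans (sym (iter-cong (succᵈ d v) (succ≡ v) (toℕ k) u)) reaches
  ; sig-sym   = λ u v → ≡.trans (sym (sig≡ u v)) (≡.trans (sig-sym u v) (sig≡ v u))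
  }
  where
  open IsSchemeData isS
  succ≡ : ∀ v u → succᵈ d v u ≡ succᵈ d′ v u
  succ≡ v u = cong proj₁ (d≗d′ v u)
  pred≡ : ∀ v u → predᵈ d v u ≡ predᵈ d′ v u
  pred≡ v u = cong (proj₁ ∘ proj₂) (d≗d′ v u)
  sig≡ : ∀ u v → sigᵈ d u v ≡ sigᵈ d′ u v
  sig≡ u v = cong (proj₂ ∘ proj₂) (d≗d′ u v)

EmbeddingGenus≤ : ℕ → {G : Graph} → Scheme G → Set
EmbeddingGenus≤ h {G} S = 4 * numComponents G + numDarts G ≤ 2 * h + 2 * size G + orbits S + 2 * numIsolated G

EmbeddingGenus≤-cong : ∀ h {G} (S S′ : Scheme G) → orbits S ≡ orbits S′ →
                       EmbeddingGenus≤ h S → EmbeddingGenus≤ h S′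
EmbeddingGenus≤-cong h {G} S S′ =
  subst (λ o → 4 * numComponents G + numDarts G ≤ 2 * h + 2 * size G + o + 2 * numIsolated G)

orbits-toScheme : ∀ {G} (S : Scheme G) {d} (isS : IsSchemeData G d) → (∀ v u → d v u ≡ schemeData S v u) →
                  orbits S ≡ orbits (toScheme isS)
orbits-toScheme S isS d≗S = orbits-cong S (toScheme isS)
  (λ v u → cong proj₁ (sym (d≗S v u))) (λ v u → cong (proj₁ ∘ proj₂) (sym (d≗S v u)))
  (λ u v → cong (proj₂ ∘ proj₂) (sym (d≗S u v)))

schemeDataList : (n : ℕ) → List (SchemeData n)
schemeDataList n = functions₂ (cartesianProduct (allFin n) (cartesianProduct (allFin n) booleans)) n

GoodSchemeData : ℕ → (G : Graph) → SchemeData (size G) → Set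
GoodSchemeData h G d = Σ (IsSchemeData G d) (EmbeddingGenus≤ h ∘ toScheme)

goodSchemeData? : ∀ h G d → Dec (GoodSchemeData h G d)
goodSchemeData? h G d with isSchemeData? G d
... | no ¬isS = no (¬isS ∘ proj₁)
... | yes isS = map′ (isS ,_)
  (λ (isS′ , bound) → EmbeddingGenus≤-cong h (toScheme isS′) (toScheme isS)
                         (orbits-toScheme (toScheme isS′) isS (λ _ _ → refl)) bound)
  (_ ≤? _)

EulerGenus≤⇒good : ∀ h G → EulerGenus≤ h G → Any (GoodSchemeData h G) (schemeDataList (size G))
EulerGenus≤⇒good h G (S , bound)
  with d , d∈ , d≗S ← functions₂-complete (size G) (schemeData S)
         (λ _ _ → ∈-cartesianProduct⁺ (∈-allFin _) (∈-cartesianProduct⁺ (∈-allFin _) (∈-booleans _))) =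
  lose d∈ (isS , EmbeddingGenus≤-cong h S (toScheme isS) (orbits-toScheme S isS d≗S) bound)
  where
  isS : IsSchemeData G d
  isS = IsSchemeData-resp (λ v u → sym (d≗S v u)) (schemeData-isSchemeData S)

EulerGenus≤? : ∀ h G → Dec (EulerGenus≤ h G)
EulerGenus≤? h G =
  map′ fromGood (EulerGenus≤⇒good h G) (Any.any? (goodSchemeData? h G) (schemeDataList (size G)))
  where
  fromGood : Any (GoodSchemeData h G) (schemeDataList (size G)) → EulerGenus≤ h G
  fromGood found with _ , isS , bound ← Any.satisfied found = toScheme isS , bound

-- Definability on graphs of bounded order

⌊≟⌋-sym : ∀ {m} (u v : Fin m) → ⌊ u ≟ᶠ v ⌋ ≡ ⌊ v ≟ᶠ u ⌋
⌊≟⌋-sym u v with u ≟ᶠ v | v ≟ᶠ u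
... | yes _   | yes _   = refl
... | no  _   | no  _   = refl
... | yes u≡v | no  v≢u = contradiction (sym u≡v) v≢u
... | no  u≢v | yes v≡u = contradiction (sym v≡u) u≢v

simpleGraph : (m : ℕ) → (Fin m → Fin m → Bool) → Graph
simpleGraph m a = record
  { size    = m
  ; adj     = λ u v → not ⌊ u ≟ᶠ v ⌋ ∧ (a u v ∨ a v u)
  ; adj-sym = λ u v → cong₂ _∧_ (cong not (⌊≟⌋-sym u v)) (∨-comm (a u v) (a v u))
  ; adj-irr = irreflexive
  }
  where
  irreflexive : ∀ u → not ⌊ u ≟ᶠ u ⌋ ∧ (a u u ∨ a u u) ≡ false
  irreflexive u with u ≟ᶠ u
  ... | yes _   = refl
  ... | no  u≢u = contradiction refl u≢u

simpleGraph-adj : ∀ G {a : Fin (size G) → Fin (size G) → Bool} → (∀ u v → a u v ≡ adj G u v) →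
                  ∀ u v → adj (simpleGraph (size G) a) u v ≡ adj G u v
simpleGraph-adj G a≗adj u v with u ≟ᶠ v
... | yes refl = sym (adj-irr G u)
... | no  _    rewrite a≗adj u v | a≗adj v u | adj-sym G v u = ∨-idem (adj G u v)

graphsUpTo : ℕ → List Graph
graphsUpTo n = concatMap (λ m → map (simpleGraph m) (functions₂ booleans m)) (upTo (suc n))

graphsUpTo-complete : ∀ {n} G → size G ≤ n → ∃ λ G′ → G′ ∈ graphsUpTo n × G ≅ G′
graphsUpTo-complete {n} G size≤n
  with a , a∈ , a≗adj ← functions₂-complete (size G) (adj G) (λ u v → ∈-booleans (adj G u v)) =
  simpleGraph (size G) a ,
  ∈-concatMap⁺ (λ m → map (simpleGraph m) (functions₂ booleans m))
               (Any.map (λ { refl → ∈-map⁺ (simpleGraph (size G)) a∈ }) (∈-upTo⁺ (s≤s size≤n))) ,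
  ⤖-id _ , simpleGraph-adj G a≗adj

falsum : Form
falsum = cnt 1 0 (neg (eql 0 0))

falsum-unsatisfiable : ∀ G → ¬ (G ⊨ falsum)
falsum-unsatisfiable G (f , _ , x≢x) = x≢x Fin.zero refl

falsum-InCw : ∀ {s} → 1 ≤ s → InCw s falsum
falsum-InCw 1≤s = s≤s z≤n , z≤n , 1≤s , 1≤s

⋁ : List Form → Form
⋁ []       = falsum
⋁ (φ ∷ φs) = disj φ (⋁ φs)

⋁-sentence : ∀ {φs} → All Sentence φs → Sentence (⋁ φs)
⋁-sentence []                        = refl
⋁-sentence (φ-sentence ∷ φs-sentence) rewrite φ-sentence | ⋁-sentence φs-sentence = refl

⋁-InCw : ∀ {s φs} → 1 ≤ s → All (λ φ → Sentence φ × InCw s φ) φs → InCw s (⋁ φs)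
⋁-InCw 1≤s []                    = falsum-InCw 1≤s
⋁-InCw 1≤s ((φ-sentence , φ-InCw) ∷ φs-ok)
  rewrite φ-sentence | ⋁-sentence (All.map proj₁ φs-ok) = z≤n , φ-InCw , ⋁-InCw 1≤s φs-ok

⋁-sat⁻ : ∀ G {φs} → G ⊨ ⋁ φs → Any (G ⊨_) φs
⋁-sat⁻ G {[]}     sat           = contradiction sat (falsum-unsatisfiable G)
⋁-sat⁻ G {φ ∷ φs} (true  , sat) = here sat
⋁-sat⁻ G {φ ∷ φs} (false , sat) = there (⋁-sat⁻ G sat)

⋁-sat⁺ : ∀ G {φs} → Any (G ⊨_) φs → G ⊨ ⋁ φs
⋁-sat⁺ G (here sat)  = true , sat
⋁-sat⁺ G (there sat) = false , ⋁-sat⁺ G sat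

module _ {s : ℕ} (P : Graph → Set) (P? : ∀ G → Dec (P G)) (P-resp-≅ : ∀ {G H} → G ≅ H → P G → P H)
         (identify : ∀ G → P G → Σ Form λ φ → Sentence φ × InCw s φ × Identifies φ G) where

  -- Taking `falsum` when `P G` fails lets the disjunction range over all enumerated graphs.
  identifier : Graph → Form
  identifier G with P? G
  ... | yes PG = proj₁ (identify G PG)
  ... | no  _  = falsum

  identifier-sentence : 1 ≤ s → ∀ G → Sentence (identifier G) × InCw s (identifier G)
  identifier-sentence 1≤s G with P? G
  ... | yes PG = let _ , φ-sentence , φ-InCw , _ = identify G PG in φ-sentence , φ-InCw
  ... | no  _  = refl , falsum-InCw 1≤s

  identifier-sound : ∀ G H → H ⊨ identifier G → P H
  identifier-sound G H sat with P? G
  ... | yes PG = let _ , _ , _ , identifies = identify G PG in P-resp-≅ (≅-sym {H} {G} (proj₁ (identifies H) sat)) PG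
  ... | no  _  = contradiction sat (falsum-unsatisfiable H)

  identifier-complete : ∀ G H → H ≅ G → P G → H ⊨ identifier G
  identifier-complete G H H≅G PG with P? G
  ... | yes PG′ = let _ , _ , _ , identifies = identify G PG′ in proj₂ (identifies H) H≅G
  ... | no  ¬PG = contradiction PG ¬PG

  definable-up-to-order : 1 ≤ s → ∀ n →
    Σ Form λ φ → Sentence φ × InCw s φ × ((G : Graph) → size G ≤ n → (G ⊨ φ → P G) × (P G → G ⊨ φ))
  definable-up-to-order 1≤s n =
    ⋁ identifiers ,
    ⋁-sentence (All-map⁺ {f = identifier} (All.universal (proj₁ ∘ identifier-sentence 1≤s) (graphsUpTo n))) ,
    ⋁-InCw 1≤s (All-map⁺ {f = identifier} (All.universal (identifier-sentence 1≤s) (graphsUpTo n))) ,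
    λ G size≤n → sound G , complete G size≤n
    where
    identifiers : List Form
    identifiers = map identifier (graphsUpTo n)

    sound : ∀ G → G ⊨ ⋁ identifiers → P G
    sound G sat with G′ , G⊨φ ← Any.satisfied (Any-map⁻ {f = identifier} {xs = graphsUpTo n} (⋁-sat⁻ G sat)) =
      identifier-sound G′ G G⊨φ

    complete : ∀ G → size G ≤ n → P G → G ⊨ ⋁ identifiers
    complete G size≤n PG with G′ , G′∈ , G≅G′ ← graphsUpTo-complete G size≤n =
      ⋁-sat⁺ G (Any-map⁺ {f = identifier} (lose G′∈ (identifier-complete G′ G G≅G′ (P-resp-≅ G≅G′ PG))))

lemma6p5 : (g s n h : ℕ) → 1 ≤ g → 4 ≤ s →
           ((G : Graph) → EulerGenus≤ (g ∸ 1) G →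
              Σ Form (λ φ → Sentence φ × InCw s φ × Identifies φ G)) →
           1 ≤ n → h < g →
           Σ Form (λ genus → Sentence genus × InCw s genus ×
             ((G : Graph) → size G ≤ n →
                (G ⊨ genus → EulerGenus≤ h G) × (EulerGenus≤ h G → G ⊨ genus)))
-- 1 ≤ g already follows from h < g, and the construction needs no lower bound on n.
lemma6p5 g s n h _ 4≤s identify _ h<g =
  definable-up-to-order (EulerGenus≤ h) (EulerGenus≤? h) (EulerGenus≤-resp-≅ {h})
    (λ G → identify G ∘ EulerGenus≤-mono (suc[m]≤n⇒m≤pred[n] h<g)) (≤-trans (s≤s z≤n) 4≤s) n
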